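{- Assume $\Diamond\in\mathcal{O}$. Then every basic partial isomorphism that belongs to a back-and-forth system between $\Delta$-models $\mathfrak{M}$ and $\mathfrak{N}$ is a partial isomorphism, i.e. for all $\lambda\in P$ and all $w_1,w_2\in\mathrm{dom}(h)$: $w_1\mathrel{\lambda^{\mathfrak{M}}}w_2$ iff $h(w_1)\mathrel{\lambda^{\mathfrak{N}}}h(w_2)$.
   Context: Hybrid-dynamic propositional logic (HDPL). A signature is $\Delta=((F,P),\mathtt{Prop})$ with $F$ nominals, $P$ binary relation symbols, $\mathtt{Prop}$ propositional symbols. A $\Delta$-model $\mathfrak{M}$: a nonempty set $|\mathfrak{M}|$ of states, states $k^{\mathfrak{M}}$ ($k\in F$), relations $\lambda^{\mathfrak{M}}$ ($\lambda\in P$), $M(w)\subseteq\mathtt{Prop}$ for each state. Actions: $\mathfrak{a}::=\lambda\mid\mathfrak{a}\cup\mathfrak{a}\mid\mathfrak{a};\mathfrak{a}\mid\mathfrak{a}^*$, interpreted as union, composition, reflexive-transitive closure. $\mathcal{L}$ is a fragment of HDPL obtained by discarding some action constructors (relation symbols $\lambda$ are always actions) and/or some sentence constructors among $\Diamond$ (possibility over actions), $@$ (retrieve), $\downarrow$ (store), $\exists$; $\mathcal{O}$ is the set of retained constructors. Basic sentences $\mathrm{Sen}_b(\Delta)=F\cup\mathtt{Prop}$. A basic partial isomorphism $h:\mathfrak{M}\nrightarrow\mathfrak{N}$ is a bijection from a subset of $|\mathfrak{M}|$ onto a subset of $|\mathfrak{N}|$ such that for all $w\in\mathrm{dom}(h)$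 and $\rho\in\mathrm{Sen}_b(\Delta)$, $(\mathfrak{M},w)\models\rho$ iff $(\mathfrak{N},h(w))\models\rho$ (a nominal $k$ holds at $w$ iff $w=k^{\mathfrak{M}}$; $p$ iff $p\in M(w)$). $h\subseteq g$ means $g$ extends $h$. A back-and-forth system between $\mathfrak{M}$ and $\mathfrak{N}$ is a nonempty family $\mathcal{I}$ of basic partial isomorphisms such that: ($@$-extension) if $@\in\mathcal{O}$, for all $h\in\mathcal{I}$, $k\in F$ there is $g\in\mathcal{I}$ with $h\subseteq g$ and $k^{\mathfrak{M}}\in\mathrm{dom}(g)$; ($\Diamond$-extension) if $\mathcal{L}$ has possibility over an action $\mathfrak{a}$: (forth) for all $h\in\mathcal{I}$, $w_1\in\mathrm{dom}(h)$, $w_2$ with $w_1\mathrel{\mathfrak{a}^{\mathfrak{M}}}w_2$ there is $g\in\mathcal{I}$, $h\subseteq g$, $w_2\in\mathrm{dom}(g)$, $g(w_1)\mathrel{\mathfrak{a}^{\mathfrak{N}}}g(w_2)$; (back) for all $h\in\mathcal{I}$, $v_1\in\mathrm{rng}(h)$, $v_2$ with $v_1\mathrel{\mathfrak{a}^{\mathfrak{N}}}v_2$ there is $g\in\mathcal{I}$, $h\subseteq g$, $v_2\in\mathrm{rng}(g)$, $g^{ -1}(v_1)\mathrel{\mathfrak{a}^{\mathfrak{M}}}g^{ -1}(v_2)$; ($\exists$-extension) if $\exists\in\mathcal{O}$: for all $h\in\mathcal{I}$ and $w\in|\mathfrak{M}|$ some $g\in\mathcal{I}$ extends $h$ with $w\in\mathrm{dom}(g)$,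 and for all $v\in|\mathfrak{N}|$ some $g\in\mathcal{I}$ extends $h$ with $v\in\mathrm{rng}(g)$. -}

module Defs where

open import Data.Bool using (Bool; T)
open import Data.Product using (Σ; ∃; _×_; _,_)
open import Data.Sum using (_⊎_)
open import Relation.Binary.PropositionalEquality using (_≡_)
open import Relation.Binary.Construct.Closure.ReflexiveTransitive using (Star)
open import Function.Bundles using (_⇔_)

record Signature : Set₁ where
  field
    F    : Set
    P    : Set
    Prop : Set

record Model (Δ : Signature) : Set₁ where
  open Signature Δ
  field
    W       : Set
    nonempty : W
    nom     : F → W
    rel     : P → W → W → Set
    val     : W → Prop → Set

data Action (P : Set) : Set where
  act  : P → Action P
  _∪ₐ_ : Action P → Action P → Action P
  _⨾ₐ_ : Action P → Action P → Action P
  _*ₐ  : Action P → Action P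

⟦_⟧ₐ : ∀ {Δ} → Action (Signature.P Δ) → (M : Model Δ) → Model.W M → Model.W M → Set
⟦ act l ⟧ₐ M w w′ = Model.rel M l w w′
⟦ a ∪ₐ b ⟧ₐ M w w′ = ⟦ a ⟧ₐ M w w′ ⊎ ⟦ b ⟧ₐ M w w′
⟦ a ⨾ₐ b ⟧ₐ M w w′ = ∃ λ u → ⟦ a ⟧ₐ M w u × ⟦ b ⟧ₐ M u w′
⟦ a *ₐ ⟧ₐ M w w′ = Star (⟦ a ⟧ₐ M) w w′

-- A fragment L: which action constructors and which sentence constructors
-- (◇, @, ↓, ∃) are retained. Relation symbols are always actions.
record Fragment : Set where
  field
    hasUnion hasComp hasStar : Bool
    hasDiamond hasAt hasStore hasExists : Bool

data ActionIn (L : Fragment) {P : Set} : Action P → Set where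
  act-in  : ∀ l → ActionIn L (act l)
  ∪-in    : ∀ {a b} → T (Fragment.hasUnion L) → ActionIn L a → ActionIn L b → ActionIn L (a ∪ₐ b)
  ⨾-in    : ∀ {a b} → T (Fragment.hasComp L) → ActionIn L a → ActionIn L b → ActionIn L (a ⨾ₐ b)
  *-in    : ∀ {a} → T (Fragment.hasStar L) → ActionIn L a → ActionIn L (a *ₐ)

module _ {Δ : Signature} (M N : Model Δ) where
  open Signature Δ
  private
    module M = Model M
    module N = Model N

  -- A partial bijection h : M ⇀ N, represented by its graph:
  -- a functional and injective relation between |M| and |N|.
  -- dom(h) = { w | ∃ v. graph w v },  rng(h) = { v | ∃ w. graph w v }.
  record PartialBij : Set₁ where
    field
      graph      : M.W → N.W → Set
      functional : ∀ {w v v′} → graph w v → graph w v′ → v ≡ v′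
      injective  : ∀ {w w′ v} → graph w v → graph w′ v → w ≡ w′
  open PartialBij public

  IsBasic : PartialBij → Set
  IsBasic h = ∀ {w v} → graph h w v →
    (∀ (k : F) → (w ≡ M.nom k) ⇔ (v ≡ N.nom k)) ×
    (∀ (p : Prop) → M.val w p ⇔ N.val v p)

  record BasicPartialIso : Set₁ where
    field
      bij   : PartialBij
      basic : IsBasic bij
  open BasicPartialIso public

  _⊆_ : BasicPartialIso → BasicPartialIso → Set
  h ⊆ g = ∀ {w v} → graph (bij h) w v → graph (bij g) w v

  record IsBackAndForth (L : Fragment) (I : BasicPartialIso → Set) : Set₁ where
    field
      nonemptyI : ∃ λ h → I h
      at-ext : T (Fragment.hasAt L) → ∀ h → I h → ∀ (k : F) →
        ∃ λ g → I g × h ⊆ g × ∃ λ v → graph (bij g) (M.nom k) v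
      ◇-forth : T (Fragment.hasDiamond L) → ∀ (a : Action P) → ActionIn L a →
        ∀ h → I h → ∀ {w₁ v₁} → graph (bij h) w₁ v₁ → ∀ w₂ → ⟦ a ⟧ₐ M w₁ w₂ →
        ∃ λ g → I g × h ⊆ g × ∃ λ v₂ → graph (bij g) w₂ v₂ × ⟦ a ⟧ₐ N v₁ v₂
      ◇-back : T (Fragment.hasDiamond L) → ∀ (a : Action P) → ActionIn L a →
        ∀ h → I h → ∀ {w₁ v₁} → graph (bij h) w₁ v₁ → ∀ v₂ → ⟦ a ⟧ₐ N v₁ v₂ →
        ∃ λ g → I g × h ⊆ g × ∃ λ w₂ → graph (bij g) w₂ v₂ × ⟦ a ⟧ₐ M w₁ w₂
      ∃-forth : T (Fragment.hasExists L) → ∀ h → I h → ∀ (w : M.W) →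
        ∃ λ g → I g × h ⊆ g × ∃ λ v → graph (bij g) w v
      ∃-back : T (Fragment.hasExists L) → ∀ h → I h → ∀ (v : N.W) →
        ∃ λ g → I g × h ⊆ g × ∃ λ w → graph (bij g) w v

  IsPartialIso : BasicPartialIso → Set
  IsPartialIso h = ∀ (l : P) {w₁ w₂ v₁ v₂} →
    graph (bij h) w₁ v₁ → graph (bij h) w₂ v₂ →
    M.rel l w₁ w₂ ⇔ N.rel l v₁ v₂

-- A relation step between two points of dom(h) is an instance of the ◇-zig
-- (resp. zag) for the atomic action; the extension g found there must agree
-- with h on the target point because g is functional (resp. injective).
module Submission where

open import Defs
open import Data.Bool using (T)
open import Data.Product using (_,_)
open import Relation.Binary.PropositionalEquality using (subst)
open import Function.Bundles using (mk⇔)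

module _ {Δ : Signature} {M N : Model Δ} {L : Fragment} {I : BasicPartialIso M N → Set}
         (bf : IsBackAndForth M N L I) (◇∈L : T (Fragment.hasDiamond L))
         {a : Action (Signature.P Δ)} (a∈L : ActionIn L a)
         {h : BasicPartialIso M N} (h∈I : I h)
         {w₁ w₂ v₁ v₂} (hw₁ : graph (bij h) w₁ v₁) (hw₂ : graph (bij h) w₂ v₂)
         where
  open IsBackAndForth bf

  action-preserved : ⟦ a ⟧ₐ M w₁ w₂ → ⟦ a ⟧ₐ N v₁ v₂
  action-preserved step with ◇-forth ◇∈L a a∈L h h∈I hw₁ w₂ step
  ... | g , _ , h⊆g , _ , gw₂ , step′ =
    subst (⟦ a ⟧ₐ N v₁) (functional (bij g) gw₂ (h⊆g hw₂)) step′

  action-reflected : ⟦ a ⟧ₐ N v₁ v₂ → ⟦ a ⟧ₐ M w₁ w₂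
  action-reflected step with ◇-back ◇∈L a a∈L h h∈I hw₁ v₂ step
  ... | g , _ , h⊆g , _ , gw₂ , step′ =
    subst (⟦ a ⟧ₐ M w₁) (injective (bij g) gw₂ (h⊆g hw₂)) step′

mainTheorem5 : (Δ : Signature) (L : Fragment) → T (Fragment.hasDiamond L) →
    (M N : Model Δ) (I : BasicPartialIso M N → Set) → IsBackAndForth M N L I →
    ∀ (h : BasicPartialIso M N) → I h → IsPartialIso M N h
mainTheorem5 Δ L ◇∈L M N I bf h h∈I l hw₁ hw₂ =
  mk⇔ (action-preserved bf ◇∈L (act-in l) h∈I hw₁ hw₂)
      (action-reflected bf ◇∈L (act-in l) h∈I hw₁ hw₂)
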